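{- Let $(X_1,I_1,Y_1)$ and $(X_2,I_2,Y_2)$ be polarities and $p:X_2\to X_1$, $q:Y_2\to Y_1$ maps, $\pi=(p,q)$. The following are equivalent: (1) for every increasing subset $A\subseteq X_1$, $q^{ -1}(\Diamond_1A)\subseteq\Diamond_2\,p^{ -1}(A)$; (2) for every $x\in X_1$, $q^{ -1}(\Diamond_1\Gamma x)\subseteq\Diamond_2\,p^{ -1}(\Gamma x)$; (3) for all $x\in X_1$ and $y'\in Y_2$: if $xI_1q(y')$ then there exists $x'\in X_2$ with $x\le p(x')$ and $x'I_2y'$.
   Context: A polarity is $(X,I,Y)$ with $X,Y$ nonempty, $I\subseteq X\times Y$; $x\perp y$ iff $(x,y)\notin I$; $U^\perp=\{y:x\perp y\ \forall x\in U\}$, ${}^\perp V=\{x:x\perp y\ \forall y\in V\}$. Preorder on $X$: $x\le z$ iff $\{x\}^\perp\subseteq\{z\}^\perp$; $\Gamma x=\{z\in X: x\le z\}$; $A\subseteq X$ is increasing if $x\in A$ and $x\le z$ imply $z\in A$. For $U\subseteq X$: $\Diamond U=\{y\in Y:\exists x\in X\,(xIy\wedge x\in U)\}$ (with subscript indicating the polarity). -}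

module Defs where

open import Level using (Level; _⊔_; suc)
open import Data.Product using (Σ; ∃; _×_; _,_)
open import Relation.Nullary using (¬_)
open import Relation.Unary using (Pred; _⊆_)

record Polarity (ℓ : Level) : Set (suc ℓ) where
  field
    X : Set ℓ
    Y : Set ℓ
    I : X → Y → Set ℓ
    X-nonempty : X
    Y-nonempty : Y

module _ {ℓ : Level} (P : Polarity ℓ) where
  open Polarity P

  _⊥_ : X → Y → Set ℓ
  x ⊥ y = ¬ I x y

  perpˣ : X → Pred Y ℓ
  perpˣ x y = x ⊥ y

  _≼_ : X → X → Set ℓ
  x ≼ z = perpˣ x ⊆ perpˣ z

  Γ : X → Pred X ℓ
  Γ x z = x ≼ z

  Increasing : Pred X ℓ → Set ℓ
  Increasing A = ∀ {x z} → A x → x ≼ z → A z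

  ◇ : Pred X ℓ → Pred Y ℓ
  ◇ U y = Σ X (λ x → I x y × U x)

preimage : {a b ℓ : Level} {A : Set a} {B : Set b} → (A → B) → Pred B ℓ → Pred A ℓ
preimage f U a = U (f a)

{-# OPTIONS --safe #-}
module Submission where

open import Defs
open import Level using (Level)
open import Data.Product using (Σ; _×_; _,_)
open import Relation.Unary using (Pred; _⊆_)

-- The principal up-sets Γ x are the smallest increasing sets containing x, so
-- (1) specialises to (2); conversely, (2) applied to the witness x of
-- q y′ ∈ ◇₁ (Γ x) yields (3), and (3) extends to any increasing A ∋ x.

module _ {ℓ : Level} (P : Polarity ℓ) where
  open Polarity P

  ≼-refl : {x : X} → _≼_ P x x
  ≼-refl y∈x⊥ = y∈x⊥

  ≼-trans : {x z w : X} → _≼_ P x z → _≼_ P z w → _≼_ P x w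
  ≼-trans x≼z z≼w y∈x⊥ = z≼w (x≼z y∈x⊥)

  Γ-increasing : (x : X) → Increasing P (Γ P x)
  Γ-increasing x = ≼-trans

module _ {ℓ : Level} (P₁ P₂ : Polarity ℓ)
         (p : Polarity.X P₂ → Polarity.X P₁) (q : Polarity.Y P₂ → Polarity.Y P₁) where
  open Polarity P₁ using () renaming (X to X₁; I to I₁)
  open Polarity P₂ using () renaming (X to X₂; Y to Y₂; I to I₂)

  ◇-PreimageOn : Pred X₁ ℓ → Set ℓ
  ◇-PreimageOn A = preimage q (◇ P₁ A) ⊆ ◇ P₂ (preimage p A)

  BackCondition : Set ℓ
  BackCondition = (x : X₁) (y′ : Y₂) → I₁ x (q y′) → Σ X₂ (λ x′ → _≼_ P₁ x (p x′) × I₂ x′ y′)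

  ◇-preimage-increasing⇒principal :
    ((A : Pred X₁ ℓ) → Increasing P₁ A → ◇-PreimageOn A) → (x : X₁) → ◇-PreimageOn (Γ P₁ x)
  ◇-preimage-increasing⇒principal increasing x = increasing (Γ P₁ x) (Γ-increasing P₁ x)

  ◇-preimage-principal⇒back : ((x : X₁) → ◇-PreimageOn (Γ P₁ x)) → BackCondition
  ◇-preimage-principal⇒back principal x y′ xI₁qy′
    with principal x (x , xI₁qy′ , ≼-refl P₁)
  ... | x′ , x′I₂y′ , x≼px′ = x′ , x≼px′ , x′I₂y′

  back⇒◇-preimage-increasing : BackCondition → (A : Pred X₁ ℓ) → Increasing P₁ A → ◇-PreimageOn A
  back⇒◇-preimage-increasing back A A-increasing {y′} (x , xI₁qy′ , x∈A)
    with back x y′ xI₁qy′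
  ... | x′ , x≼px′ , x′I₂y′ = x′ , x′I₂y′ , A-increasing x∈A x≼px′

lemma3p18 : {ℓ : Level} (P₁ P₂ : Polarity ℓ)
    → (p : Polarity.X P₂ → Polarity.X P₁) (q : Polarity.Y P₂ → Polarity.Y P₁)
    → let
        cond1 = (A : Pred (Polarity.X P₁) ℓ) → Increasing P₁ A
                  → preimage q (◇ P₁ A) ⊆ ◇ P₂ (preimage p A)
        cond2 = (x : Polarity.X P₁)
                  → preimage q (◇ P₁ (Γ P₁ x)) ⊆ ◇ P₂ (preimage p (Γ P₁ x))
        cond3 = (x : Polarity.X P₁) (y′ : Polarity.Y P₂)
                  → Polarity.I P₁ x (q y′)
                  → Σ (Polarity.X P₂) (λ x′ → _≼_ P₁ x (p x′) × Polarity.I P₂ x′ y′)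
      in (cond1 → cond2) × (cond2 → cond3) × (cond3 → cond1)
lemma3p18 P₁ P₂ p q =
    ◇-preimage-increasing⇒principal P₁ P₂ p q
  , ◇-preimage-principal⇒back P₁ P₂ p q
  , back⇒◇-preimage-increasing P₁ P₂ p q
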